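{- Let $\Sigma$ be a signed graph. Then $\mathsf E(\Sigma,x,x)=\mathsf E(\Sigma^+,x)=\mathsf O(\Sigma^+,x)$.
   Context: A signed graph $\Sigma=(\Gamma,\sigma)$ is a finite simple graph $\Gamma$ with a signature $\sigma:E(\Gamma)\to\{\pm1\}$. $\Sigma^+$ denotes the all-positive signed graph with vertex set $V(\Gamma)$ and edge set $\sigma^{ -1}(1)$ (the positive edges of $\Sigma$). For a finite $C\subseteq\mathbb Z$, a proper $C$-colouring of $\Sigma$ is a map $\kappa:V(\Gamma)\to C$ with $\kappa(v)\ne\sigma(\{v,w\})\kappa(w)$ for every edge $\{v,w\}$. Univariate: for $\lambda\ge0$, $C_\lambda$ is the set of nonzero integers in $[-\lambda/2,\lambda/2]$ if $\lambda$ is even and the set of integers in $[-(\lambda-1)/2,(\lambda-1)/2]$ if $\lambda$ is odd; $f(\Sigma,\lambda)$ is the number of proper $C_\lambda$-colourings; $\mathsf E(\Sigma,x),\mathsf O(\Sigma,x)\in\mathbb Z[x]$ are the unique polynomials with $f(\Sigma,\lambda)=\mathsf E(\Sigma,\lambda)$ for even $\lambda\ge0$ and $=\mathsf O(\Sigma,\lambda)$ for odd $\lambda\ge0$. Bivariate: for integers $\lambda\ge\mu\ge0$, a finite $C\subseteq\mathbb Z$ is a $(\lambda,\mu)$-colour set if there are disjoint sets $P,U$ of nonzero integers with $-P=P$, $|U|=\mu$, $(-U)\cap U=\varnothing$, and either $\lambda-\mu$ even, $|P|=\lambda-\mu$, $C=P\cup U$, or $\lambda-\mu$ odd, $|P|=\lambda-\mu-1$,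 $C=P\cup U\cup\{0\}$. $f(\Sigma,\lambda,\mu)$ is the number of proper $C$-colourings for any $(\lambda,\mu)$-colour set $C$ (independent of $C$). $\mathsf E(\Sigma,x,y)\in\mathbb Z[x,y]$ is the unique polynomial with $f(\Sigma,\lambda,\mu)=\mathsf E(\Sigma,\lambda,\mu)$ for all integers $\lambda\ge\mu\ge0$ with $\lambda-\mu$ even. -}

module Defs where

open import Data.Bool using (Bool; true; false; not; _∧_; if_then_else_)
open import Data.Nat as ℕ using (ℕ; zero; suc; _∸_; _/_; _%_; _≤_)
open import Data.Nat.Divisibility using (_∣_)
open import Data.Integer as ℤ using (ℤ; +_; -_; _+_; _*_; 0ℤ)
open import Data.Fin using (Fin)
open import Data.Vec as Vec using (Vec; []; _∷_; lookup)
open import Data.List as List using (List; []; _∷_; _++_; map; concatMap; length; filterᵇ; upTo; allFin; foldr)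
open import Data.List.Membership.Propositional using (_∈_; _∉_)
open import Data.List.Relation.Unary.All using (All)
open import Data.List.Relation.Unary.Unique.Propositional using (Unique)
open import Data.Maybe using (Maybe; just; nothing)
open import Data.Sign using (Sign) renaming (+ to plus; - to minus)
open import Data.Product using (Σ; ∃; ∃₂; _×_; _,_)
open import Relation.Binary.PropositionalEquality using (_≡_; _≢_; cong)
import Data.Sum
open import Relation.Nullary using (¬_)
open import Relation.Nullary.Decidable using (⌊_⌋)

-- Signed graphs: finite simple graph on vertex set Fin n, where
-- sgn v w = nothing  means  {v,w} is not an edge,
-- sgn v w = just s   means  {v,w} is an edge with sign s.

record SignedGraph : Set where
  field
    n      : ℕ
    sgn    : Fin n → Fin n → Maybe Sign
    sgn-sym : ∀ v w → sgn v w ≡ sgn w v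
    loopless : ∀ v → sgn v v ≡ nothing

open SignedGraph public

keepPos : Maybe Sign → Maybe Sign
keepPos (just plus) = just plus
keepPos _           = nothing

_⁺ : SignedGraph → SignedGraph
G ⁺ = record
  { n = n G
  ; sgn = λ v w → keepPos (sgn G v w)
  ; sgn-sym = λ v w → cong keepPos (sgn-sym G v w)
  ; loopless = λ v → cong keepPos (loopless G v)
  }

act : Sign → ℤ → ℤ
act plus  c = c
act minus c = - c

edgeOKᵇ : Maybe Sign → ℤ → ℤ → Bool
edgeOKᵇ nothing  a b = true
edgeOKᵇ (just s) a b = not ⌊ a ℤ.≟ act s b ⌋

allᵇ : {A : Set} → (A → Bool) → List A → Bool
allᵇ p = foldr (λ a b → p a ∧ b) true

properᵇ : (G : SignedGraph) → Vec ℤ (n G) → Bool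
properᵇ G κ =
  allᵇ (λ v → allᵇ (λ w → edgeOKᵇ (sgn G v w) (lookup κ v) (lookup κ w)) (allFin (n G))) (allFin (n G))

allMaps : List ℤ → (k : ℕ) → List (Vec ℤ k)
allMaps C zero    = [] ∷ []
allMaps C (suc k) = concatMap (λ c → map (c ∷_) (allMaps C k)) C

-- number of proper C-colourings of G (C a duplicate-free list)
count : SignedGraph → List ℤ → ℕ
count G C = length (filterᵇ (properᵇ G) (allMaps C (n G)))

posUpTo : ℕ → List ℤ
posUpTo k = map (λ i → + suc i) (upTo k)

Cuni : ℕ → List ℤ
Cuni l = zeroPart ++ map -_ (posUpTo (l / 2)) ++ posUpTo (l / 2)
  where
  zeroPart : List ℤ
  zeroPart with l % 2
  ... | zero = []
  ... | suc _ = 0ℤ ∷ []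

f₁ : SignedGraph → ℕ → ℕ
f₁ G l = count G (Cuni l)

record ColourSetData (l m : ℕ) (C : List ℤ) : Set where
  field
    P U          : List ℤ
    P-unique     : Unique P
    U-unique     : Unique U
    P-nonzero    : All (_≢ 0ℤ) P
    U-nonzero    : All (_≢ 0ℤ) U
    P-symmetric  : ∀ x → x ∈ P → - x ∈ P
    U-antisym    : ∀ x → x ∈ U → - x ∉ U
    disjoint     : ∀ x → x ∈ P → x ∉ U
    U-size       : length U ≡ m
    shape        : (2 ∣ (l ∸ m) × length P ≡ l ∸ m × C ≡ P ++ U)
                   Data.Sum.⊎
                   (¬ (2 ∣ (l ∸ m)) × length P ≡ l ∸ m ∸ 1 × C ≡ 0ℤ ∷ P ++ U)

IsColourSet : ℕ → ℕ → List ℤ → Set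
IsColourSet l m C = ColourSetData l m C

-- univariate: coefficient list a₀ ∷ a₁ ∷ ... (a_i is the coefficient of x^i)
Poly₁ : Set
Poly₁ = List ℤ

-- bivariate: list of rows; row i is a univariate polynomial in y,
-- p = Σ_i x^i (row i)(y)
Poly₂ : Set
Poly₂ = List (List ℤ)

eval₁ : Poly₁ → ℤ → ℤ
eval₁ p x = foldr (λ a acc → a + x * acc) 0ℤ p

eval₂ : Poly₂ → ℤ → ℤ → ℤ
eval₂ p x y = foldr (λ row acc → eval₁ row y + x * acc) 0ℤ p

coeff₁ : Poly₁ → ℕ → ℤ
coeff₁ []      _       = 0ℤ
coeff₁ (a ∷ p) zero    = a
coeff₁ (a ∷ p) (suc i) = coeff₁ p i

coeff₂ : Poly₂ → ℕ → ℕ → ℤ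
coeff₂ []        _       j = 0ℤ
coeff₂ (r ∷ p)   zero    j = coeff₁ r j
coeff₂ (r ∷ p)   (suc i) j = coeff₂ p i j

-- coefficient of x^k in p(x,x):  Σ_{i+j=k} coeff₂ p i j
diagCoeff : Poly₂ → ℕ → ℤ
diagCoeff p k = foldr _+_ 0ℤ (map (λ i → coeff₂ p i (k ∸ i)) (upTo (suc k)))

DiagEq : Poly₂ → Poly₁ → Set
DiagEq p q = ∀ k → diagCoeff p k ≡ coeff₁ q k

PolyEq : Poly₁ → Poly₁ → Set
PolyEq p q = ∀ k → coeff₁ p k ≡ coeff₁ q k

IsE₁ : SignedGraph → Poly₁ → Set
IsE₁ G p = ∀ l → 2 ∣ l → + (f₁ G l) ≡ eval₁ p (+ l)

IsO₁ : SignedGraph → Poly₁ → Set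
IsO₁ G p = ∀ l → ¬ (2 ∣ l) → + (f₁ G l) ≡ eval₁ p (+ l)

-- f(Σ,λ,μ) is the number of proper C-colourings for any (λ,μ)-colour set C;
-- E(Σ,x,y) agrees with it whenever λ ≥ μ ≥ 0 and λ - μ is even.
IsE₂ : SignedGraph → Poly₂ → Set
IsE₂ G p = ∀ l m → m ≤ l → 2 ∣ (l ∸ m) → ∀ C → IsColourSet l m C →
           + (count G C) ≡ eval₂ p (+ l) (+ m)

-- Relabel the colours c ↦ 1 + zigzag c, an injection ℤ → ℤ_{>0}. With positive
-- colours a negative edge can never be violated (κ v = - κ w would need colours of
-- opposite signs), and a positive edge is violated exactly when the original labels
-- agree; so proper colourings of Σ by the relabelled C_λ are the proper
-- C_λ-colourings of Σ⁺. Distinct positive colours form a (λ,λ)-colour set with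
-- P = ∅, hence E(Σ,λ,λ) = f(Σ⁺,λ) for every λ ≥ 0. Thus E(Σ,x,x) agrees with
-- E(Σ⁺,x) at every even and with O(Σ⁺,x) at every odd natural number, and a
-- polynomial with unboundedly many roots is zero.
module Submission where

open import Defs
open import Data.Bool using (Bool; true; false; not; _∧_; T)
open import Data.Integer as ℤ using (ℤ; +_; +[1+_]; -[1+_]; -_; 0ℤ; _+_; _*_; _-_; ∣_∣)
import Data.Integer.Properties as ℤ
open import Data.Integer.Tactic.RingSolver using (solve-∀)
open import Data.List using (List; []; _∷_; _++_; map; concatMap; length; filterᵇ; upTo; allFin; foldr)
open import Data.List.Properties using (map-∘; length-map; length-++; length-upTo; concatMap-map; concatMap-cong; map-concatMap; map-applyUpTo; filter-≐)
open import Data.List.Membership.Propositional using (_∈_; _∉_)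
open import Data.List.Membership.Propositional.Properties using (∈-map⁻; ∈-++⁻)
open import Data.List.Relation.Unary.All as All using ([])
import Data.List.Relation.Unary.All.Properties as All
open import Data.List.Relation.Unary.AllPairs using ([]; _∷_)
open import Data.List.Relation.Unary.Unique.Propositional using (Unique)
import Data.List.Relation.Unary.Unique.Propositional.Properties as Unique
open import Data.Maybe using (just; nothing)
open import Data.Nat as ℕ using (ℕ; zero; suc; _≤_; _<_; _/_; _%_; s≤s)
import Data.Nat.Properties as ℕ
open import Data.Nat.DivMod using (m≡m%n+[m/n]*n; m%n<n)
open import Data.Nat.Divisibility using (_∣_; divides; _∣0; ∣m+n∣m⇒∣n; ∣1⇒≡1)
open import Data.Product using (∃-syntax; _×_; _,_; map₂)
open import Data.Sign using () renaming (+ to plus; - to minus)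
open import Data.Sum using (inj₁; inj₂)
open import Data.Vec as Vec using (Vec; lookup)
import Data.Vec.Properties as Vec
open import Function using (_∘_; _⇔_; mk⇔)
open import Function.Definitions using (Injective)
open import Relation.Binary.PropositionalEquality
open import Relation.Nullary using (¬_; contradiction)
open import Relation.Nullary.Decidable using (Dec; isYes; isYes≗does; does-⇔)

zigzag : ℤ → ℕ
zigzag (+ n)    = 2 ℕ.* n
zigzag -[1+ n ] = suc (2 ℕ.* n)

zigzag-injective : Injective _≡_ _≡_ zigzag
zigzag-injective {+ m}      {+ n}       eq = cong +_ (ℕ.*-cancelˡ-≡ m n 2 eq)
zigzag-injective {+ m}      { -[1+ n ]} eq = contradiction eq (ℕ.even≢odd m n)
zigzag-injective { -[1+ m ]} {+ n}       eq = contradiction (sym eq) (ℕ.even≢odd n m)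
zigzag-injective { -[1+ m ]} { -[1+ n ]} eq =
  cong -[1+_] (ℕ.*-cancelˡ-≡ m n 2 (ℕ.suc-injective eq))

filterᵇ-map : ∀ {A B : Set} (p : B → Bool) (g : A → B) xs →
              filterᵇ p (map g xs) ≡ map g (filterᵇ (p ∘ g) xs)
filterᵇ-map p g []       = refl
filterᵇ-map p g (x ∷ xs) with p (g x)
... | true  = cong (g x ∷_) (filterᵇ-map p g xs)
... | false = filterᵇ-map p g xs

filterᵇ-cong : ∀ {A : Set} {p q : A → Bool} → (∀ x → p x ≡ q x) → ∀ xs → filterᵇ p xs ≡ filterᵇ q xs
filterᵇ-cong p≗q = filter-≐ _ _ ((λ {x} → subst T (p≗q x)) , (λ {x} → subst T (sym (p≗q x))))

allMaps-map : ∀ (g : ℤ → ℤ) C k → allMaps (map g C) k ≡ map (Vec.map g) (allMaps C k)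
allMaps-map g C zero    = refl
allMaps-map g C (suc k) = begin
  concatMap (λ c → map (c Vec.∷_) (allMaps (map g C) k)) (map g C)
    ≡⟨ concatMap-map _ g C ⟩
  concatMap (λ c → map (g c Vec.∷_) (allMaps (map g C) k)) C
    ≡⟨ concatMap-cong (λ c → cong (map (g c Vec.∷_)) (allMaps-map g C k)) C ⟩
  concatMap (λ c → map (g c Vec.∷_) (map (Vec.map g) (allMaps C k))) C
    ≡⟨ concatMap-cong (λ c → trans (sym (map-∘ (allMaps C k))) (map-∘ (allMaps C k))) C ⟩
  concatMap (λ c → map (Vec.map g) (map (c Vec.∷_) (allMaps C k))) C
    ≡⟨ map-concatMap (Vec.map g) _ C ⟨
  map (Vec.map g) (allMaps C (suc k)) ∎
  where open ≡-Reasoning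

isYes-⇔ : ∀ {A B : Set} → A ⇔ B → (a? : Dec A) (b? : Dec B) → isYes a? ≡ isYes b?
isYes-⇔ A⇔B a? b? = trans (isYes≗does a?) (trans (does-⇔ A⇔B a? b?) (sym (isYes≗does b?)))

allᵇ-cong : ∀ {A : Set} {p q : A → Bool} → (∀ x → p x ≡ q x) → ∀ xs → allᵇ p xs ≡ allᵇ q xs
allᵇ-cong p≗q []       = refl
allᵇ-cong p≗q (x ∷ xs) = cong₂ _∧_ (p≗q x) (allᵇ-cong p≗q xs)

module PositiveRelabelling {e : ℤ → ℕ} (e-injective : Injective _≡_ _≡_ e) where

  relabel : ℤ → ℤ
  relabel c = +[1+ e c ]

  edgeOKᵇ-relabel : ∀ s a b → edgeOKᵇ s (relabel a) (relabel b) ≡ edgeOKᵇ (keepPos s) a b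
  edgeOKᵇ-relabel nothing      a b = refl
  edgeOKᵇ-relabel (just minus) a b = refl
  edgeOKᵇ-relabel (just plus)  a b =
    cong not (isYes-⇔ (mk⇔ (e-injective ∘ ℤ.+[1+-injective) (cong relabel)) (relabel a ℤ.≟ relabel b) (a ℤ.≟ b))

  properᵇ-relabel : ∀ G κ → properᵇ G (Vec.map relabel κ) ≡ properᵇ (G ⁺) κ
  properᵇ-relabel G κ =
    allᵇ-cong (λ v → allᵇ-cong (λ w → edge v w) (allFin (n G))) (allFin (n G))
    where
    edge : ∀ v w → edgeOKᵇ (sgn G v w) (lookup (Vec.map relabel κ) v) (lookup (Vec.map relabel κ) w)
                 ≡ edgeOKᵇ (keepPos (sgn G v w)) (lookup κ v) (lookup κ w)
    edge v w = trans (cong₂ (edgeOKᵇ (sgn G v w)) (Vec.lookup-map v relabel κ) (Vec.lookup-map w relabel κ))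
                     (edgeOKᵇ-relabel (sgn G v w) (lookup κ v) (lookup κ w))

  count-relabel : ∀ G C → count G (map +[1+_] (map e C)) ≡ count (G ⁺) C
  count-relabel G C = begin
    count G (map +[1+_] (map e C))
      ≡⟨ cong (count G) (map-∘ C) ⟨
    length (filterᵇ (properᵇ G) (allMaps (map relabel C) (n G)))
      ≡⟨ cong (length ∘ filterᵇ (properᵇ G)) (allMaps-map relabel C (n G)) ⟩
    length (filterᵇ (properᵇ G) (map (Vec.map relabel) κs))
      ≡⟨ cong length (filterᵇ-map (properᵇ G) (Vec.map relabel) κs) ⟩
    length (map (Vec.map relabel) (filterᵇ (properᵇ G ∘ Vec.map relabel) κs))
      ≡⟨ length-map (Vec.map relabel) (filterᵇ (properᵇ G ∘ Vec.map relabel) κs) ⟩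
    length (filterᵇ (properᵇ G ∘ Vec.map relabel) κs)
      ≡⟨ cong length (filterᵇ-cong (properᵇ-relabel G) κs) ⟩
    count (G ⁺) C ∎
    where
    open ≡-Reasoning
    κs : List (Vec ℤ (n G))
    κs = allMaps C (n G)

∣n∸n : ∀ d n → d ∣ n ℕ.∸ n
∣n∸n d n = subst (d ∣_) (sym (ℕ.n∸n≡0 n)) (d ∣0)

positive-isColourSet : ∀ {m} (ks : List ℕ) → Unique ks → length ks ≡ m →
                       IsColourSet m m (map +[1+_] ks)
positive-isColourSet {m} ks ks-unique ks-length = record
  { P           = []
  ; U           = map +[1+_] ks
  ; P-unique    = []
  ; U-unique    = Unique.map⁺ ℤ.+[1+-injective ks-unique
  ; P-nonzero   = []
  ; U-nonzero   = All.map⁺ (All.universal (λ _ ()) ks)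
  ; P-symmetric = λ _ ()
  ; U-antisym   = antisymmetric
  ; disjoint    = λ _ ()
  ; U-size      = trans (length-map +[1+_] ks) ks-length
  ; shape       = inj₁ (∣n∸n 2 m , sym (ℕ.n∸n≡0 m) , refl)
  }
  where
  antisymmetric : ∀ x → x ∈ map +[1+_] ks → - x ∉ map +[1+_] ks
  antisymmetric x x∈ -x∈ with ∈-map⁻ +[1+_] x∈ | ∈-map⁻ +[1+_] -x∈
  ... | _ , _ , refl | _ , _ , ()

parityZero : ℕ → List ℤ
parityZero zero    = []
parityZero (suc _) = 0ℤ ∷ []

symmetricRange : ℕ → List ℤ
symmetricRange h = map -[1+_] (upTo h) ++ map +[1+_] (upTo h)

±posUpTo≡symmetricRange : ∀ h → map -_ (posUpTo h) ++ posUpTo h ≡ symmetricRange h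
±posUpTo≡symmetricRange h = cong (_++ posUpTo h) (sym (map-∘ (upTo h)))

Cuni-split : ∀ l → Cuni l ≡ parityZero (l % 2) ++ symmetricRange (l / 2)
Cuni-split l with l % 2
... | zero  = ±posUpTo≡symmetricRange (l / 2)
... | suc _ = cong (0ℤ ∷_) (±posUpTo≡symmetricRange (l / 2))

symmetricRange-unique : ∀ h → Unique (symmetricRange h)
symmetricRange-unique h = Unique.++⁺ (Unique.map⁺ ℤ.-[1+-injective (Unique.upTo⁺ h))
                                     (Unique.map⁺ ℤ.+[1+-injective (Unique.upTo⁺ h))
                                     opposite-signs
  where
  opposite-signs : ∀ {x} → ¬ (x ∈ map -[1+_] (upTo h) × x ∈ map +[1+_] (upTo h))
  opposite-signs (x∈ₗ , x∈ᵣ) with ∈-map⁻ -[1+_] x∈ₗ | ∈-map⁻ +[1+_] x∈ᵣ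
  ... | _ , _ , refl | _ , _ , ()

0∉symmetricRange : ∀ h → 0ℤ ∉ symmetricRange h
0∉symmetricRange h 0∈ with ∈-++⁻ (map -[1+_] (upTo h)) 0∈
... | inj₁ 0∈ₗ with () ← ∈-map⁻ -[1+_] 0∈ₗ
... | inj₂ 0∈ᵣ with () ← ∈-map⁻ +[1+_] 0∈ᵣ

Cuni-unique : ∀ l → Unique (Cuni l)
Cuni-unique l = subst Unique (sym (Cuni-split l)) (unique (l % 2))
  where
  unique : ∀ r → Unique (parityZero r ++ symmetricRange (l / 2))
  unique zero    = symmetricRange-unique (l / 2)
  unique (suc _) = All.¬Any⇒All¬ _ (0∉symmetricRange (l / 2)) ∷ symmetricRange-unique (l / 2)

length-parityZero : ∀ {r} → r < 2 → length (parityZero r) ≡ r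
length-parityZero {zero}        _ = refl
length-parityZero {suc zero}    _ = refl
length-parityZero {suc (suc _)} (s≤s (s≤s ()))

length-symmetricRange : ∀ h → length (symmetricRange h) ≡ h ℕ.* 2
length-symmetricRange h = begin
  length (symmetricRange h)                                  ≡⟨ length-++ (map -[1+_] (upTo h)) ⟩
  length (map -[1+_] (upTo h)) ℕ.+ length (map +[1+_] (upTo h))
    ≡⟨ cong₂ ℕ._+_ (length-map -[1+_] (upTo h)) (length-map +[1+_] (upTo h)) ⟩
  length (upTo h) ℕ.+ length (upTo h)                        ≡⟨ cong₂ ℕ._+_ (length-upTo h) (length-upTo h) ⟩
  h ℕ.+ h                                                    ≡⟨ cong (h ℕ.+_) (ℕ.+-identityʳ h) ⟨
  2 ℕ.* h                                                    ≡⟨ ℕ.*-comm 2 h ⟩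
  h ℕ.* 2                                                    ∎
  where open ≡-Reasoning

length-Cuni : ∀ l → length (Cuni l) ≡ l
length-Cuni l = begin
  length (Cuni l)                                                    ≡⟨ cong length (Cuni-split l) ⟩
  length (parityZero (l % 2) ++ symmetricRange (l / 2))              ≡⟨ length-++ (parityZero (l % 2)) ⟩
  length (parityZero (l % 2)) ℕ.+ length (symmetricRange (l / 2))
    ≡⟨ cong₂ ℕ._+_ (length-parityZero (m%n<n l 2)) (length-symmetricRange (l / 2)) ⟩
  l % 2 ℕ.+ l / 2 ℕ.* 2                                              ≡⟨ m≡m%n+[m/n]*n l 2 ⟨
  l                                                                  ∎
  where open ≡-Reasoning

infixl 6 _+ₚ_ _-ₚ_

_+ₚ_ : Poly₁ → Poly₁ → Poly₁
[]      +ₚ q       = q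
(a ∷ p) +ₚ []      = a ∷ p
(a ∷ p) +ₚ (b ∷ q) = a + b ∷ p +ₚ q

negₚ : Poly₁ → Poly₁
negₚ p = map -_ p

_-ₚ_ : Poly₁ → Poly₁ → Poly₁
p -ₚ q = p +ₚ negₚ q

eval₁-+ₚ : ∀ p q x → eval₁ (p +ₚ q) x ≡ eval₁ p x + eval₁ q x
eval₁-+ₚ []      q       x = sym (ℤ.+-identityˡ (eval₁ q x))
eval₁-+ₚ (a ∷ p) []      x = sym (ℤ.+-identityʳ (eval₁ (a ∷ p) x))
eval₁-+ₚ (a ∷ p) (b ∷ q) x = begin
  a + b + x * eval₁ (p +ₚ q) x               ≡⟨ cong (λ s → a + b + x * s) (eval₁-+ₚ p q x) ⟩
  a + b + x * (eval₁ p x + eval₁ q x)        ≡⟨ regroup a b x (eval₁ p x) (eval₁ q x) ⟩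
  a + x * eval₁ p x + (b + x * eval₁ q x)    ∎
  where
  open ≡-Reasoning
  regroup : ∀ a b x s t → a + b + x * (s + t) ≡ a + x * s + (b + x * t)
  regroup = solve-∀

eval₁-negₚ : ∀ p x → eval₁ (negₚ p) x ≡ - eval₁ p x
eval₁-negₚ []      x = refl
eval₁-negₚ (a ∷ p) x = begin
  - a + x * eval₁ (negₚ p) x   ≡⟨ cong (λ s → - a + x * s) (eval₁-negₚ p x) ⟩
  - a + x * - eval₁ p x        ≡⟨ regroup a x (eval₁ p x) ⟩
  - (a + x * eval₁ p x)        ∎
  where
  open ≡-Reasoning
  regroup : ∀ a x s → - a + x * - s ≡ - (a + x * s)
  regroup = solve-∀

eval₁--ₚ : ∀ p q x → eval₁ (p -ₚ q) x ≡ eval₁ p x - eval₁ q x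
eval₁--ₚ p q x = trans (eval₁-+ₚ p (negₚ q) x) (cong (λ s → eval₁ p x + s) (eval₁-negₚ q x))

coeff₁-+ₚ : ∀ p q k → coeff₁ (p +ₚ q) k ≡ coeff₁ p k + coeff₁ q k
coeff₁-+ₚ []      q       k       = sym (ℤ.+-identityˡ (coeff₁ q k))
coeff₁-+ₚ (a ∷ p) []      k       = sym (ℤ.+-identityʳ (coeff₁ (a ∷ p) k))
coeff₁-+ₚ (a ∷ p) (b ∷ q) zero    = refl
coeff₁-+ₚ (a ∷ p) (b ∷ q) (suc k) = coeff₁-+ₚ p q k

coeff₁-negₚ : ∀ p k → coeff₁ (negₚ p) k ≡ - coeff₁ p k
coeff₁-negₚ []      k       = refl
coeff₁-negₚ (a ∷ p) zero    = refl
coeff₁-negₚ (a ∷ p) (suc k) = coeff₁-negₚ p k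

coeff₁--ₚ : ∀ p q k → coeff₁ (p -ₚ q) k ≡ coeff₁ p k - coeff₁ q k
coeff₁--ₚ p q k = trans (coeff₁-+ₚ p (negₚ q) k) (cong (λ s → coeff₁ p k + s) (coeff₁-negₚ q k))

diagonal : Poly₂ → Poly₁
diagonal []      = []
diagonal (r ∷ p) = r +ₚ (0ℤ ∷ diagonal p)

eval₁-diagonal : ∀ p x → eval₁ (diagonal p) x ≡ eval₂ p x x
eval₁-diagonal []      x = refl
eval₁-diagonal (r ∷ p) x = begin
  eval₁ (r +ₚ (0ℤ ∷ diagonal p)) x               ≡⟨ eval₁-+ₚ r (0ℤ ∷ diagonal p) x ⟩
  eval₁ r x + (0ℤ + x * eval₁ (diagonal p) x)    ≡⟨ cong (λ s → eval₁ r x + s) (ℤ.+-identityˡ _) ⟩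
  eval₁ r x + x * eval₁ (diagonal p) x           ≡⟨ cong (λ s → eval₁ r x + x * s) (eval₁-diagonal p x) ⟩
  eval₁ r x + x * eval₂ p x x                    ∎
  where open ≡-Reasoning

diagCoeff-[] : ∀ k → diagCoeff [] k ≡ 0ℤ
diagCoeff-[] k = sum-zeros (upTo (suc k))
  where
  sum-zeros : (is : List ℕ) → foldr _+_ 0ℤ (map (λ _ → 0ℤ) is) ≡ 0ℤ
  sum-zeros []       = refl
  sum-zeros (_ ∷ is) = trans (ℤ.+-identityˡ _) (sum-zeros is)

diagCoeff-∷ : ∀ r p k → diagCoeff (r ∷ p) (suc k) ≡ coeff₁ r (suc k) + diagCoeff p k
diagCoeff-∷ r p k = cong (λ s → coeff₁ r (suc k) + foldr _+_ 0ℤ s)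
  (trans (map-applyUpTo suc (λ i → coeff₂ (r ∷ p) i (suc k ℕ.∸ i)) (suc k))
         (sym (map-applyUpTo (λ i → i) (λ i → coeff₂ p i (k ℕ.∸ i)) (suc k))))

coeff₁-diagonal : ∀ p k → coeff₁ (diagonal p) k ≡ diagCoeff p k
coeff₁-diagonal []      k       = sym (diagCoeff-[] k)
coeff₁-diagonal (r ∷ p) zero    = coeff₁-+ₚ r (0ℤ ∷ diagonal p) zero
coeff₁-diagonal (r ∷ p) (suc k) = begin
  coeff₁ (r +ₚ (0ℤ ∷ diagonal p)) (suc k)     ≡⟨ coeff₁-+ₚ r (0ℤ ∷ diagonal p) (suc k) ⟩
  coeff₁ r (suc k) + coeff₁ (diagonal p) k    ≡⟨ cong (λ s → coeff₁ r (suc k) + s) (coeff₁-diagonal p k) ⟩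
  coeff₁ r (suc k) + diagCoeff p k            ≡⟨ diagCoeff-∷ r p k ⟨
  diagCoeff (r ∷ p) (suc k)                   ∎
  where open ≡-Reasoning

i+n*j≡0⇒i≡0 : ∀ i j {n} → ∣ i ∣ < n → i + + n * j ≡ 0ℤ → i ≡ 0ℤ
i+n*j≡0⇒i≡0 i j {n} ∣i∣<n i+nj≡0 = ℤ.∣i∣≡0⇒i≡0 (begin
  ∣ i ∣            ≡⟨ ∣i∣≡n*∣j∣ ⟩
  n ℕ.* ∣ j ∣      ≡⟨ cong (n ℕ.*_) ∣j∣≡0 ⟩
  n ℕ.* 0          ≡⟨ ℕ.*-zeroʳ n ⟩
  0                ∎)
  where
  open ≡-Reasoning
  ∣i∣≡n*∣j∣ : ∣ i ∣ ≡ n ℕ.* ∣ j ∣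
  ∣i∣≡n*∣j∣ = begin
    ∣ i ∣              ≡⟨ cong ∣_∣ (ℤ.i-j≡0⇒i≡j i _ (trans (cong (λ s → i + s) (ℤ.neg-involutive _)) i+nj≡0)) ⟩
    ∣ - (+ n * j) ∣    ≡⟨ ℤ.∣-i∣≡∣i∣ (+ n * j) ⟩
    ∣ + n * j ∣        ≡⟨ ℤ.abs-* (+ n) j ⟩
    n ℕ.* ∣ j ∣        ∎
  ∣j∣≡0 : ∣ j ∣ ≡ 0
  ∣j∣≡0 = ℕ.n<1⇒n≡0 (ℕ.*-cancelˡ-< n ∣ j ∣ 1
    (subst₂ _<_ ∣i∣≡n*∣j∣ (sym (ℕ.*-identityʳ n)) ∣i∣<n))

Unbounded : (ℕ → Set) → Set
Unbounded P = ∀ N → ∃[ l ] N ≤ l × P l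

UnboundedRoots : Poly₁ → Set
UnboundedRoots p = Unbounded (λ l → eval₁ p (+ l) ≡ 0ℤ)

unboundedRoots⇒head≡0 : ∀ a p → UnboundedRoots (a ∷ p) → a ≡ 0ℤ
unboundedRoots⇒head≡0 a p roots with l , ∣a∣<l , root ← roots (suc ∣ a ∣) =
  i+n*j≡0⇒i≡0 a (eval₁ p (+ l)) ∣a∣<l root

unboundedRoots-tail : ∀ a p → UnboundedRoots (a ∷ p) → UnboundedRoots p
-- Asking for a root l ≥ N + 1 makes l nonzero, so it cancels from 0 = a + l * p(l) = l * p(l).
unboundedRoots-tail a p roots N with roots (suc N)
... | suc l , s≤s N≤l , root
    with refl ← unboundedRoots⇒head≡0 a p roots
    with ℤ.i*j≡0⇒i≡0∨j≡0 (+ suc l) (trans (sym (ℤ.+-identityˡ _)) root)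
...   | inj₁ ()
...   | inj₂ tail-root = suc l , ℕ.m≤n⇒m≤1+n N≤l , tail-root

unboundedRoots⇒coeff≡0 : ∀ p → UnboundedRoots p → ∀ k → coeff₁ p k ≡ 0ℤ
unboundedRoots⇒coeff≡0 []      roots k       = refl
unboundedRoots⇒coeff≡0 (a ∷ p) roots zero    = unboundedRoots⇒head≡0 a p roots
unboundedRoots⇒coeff≡0 (a ∷ p) roots (suc k) = unboundedRoots⇒coeff≡0 p (unboundedRoots-tail a p roots) k

unboundedAgreement⇒PolyEq : ∀ p q → Unbounded (λ l → eval₁ p (+ l) ≡ eval₁ q (+ l)) → PolyEq p q
unboundedAgreement⇒PolyEq p q agree k =
  ℤ.i-j≡0⇒i≡j _ _ (trans (sym (coeff₁--ₚ p q k)) (unboundedRoots⇒coeff≡0 (p -ₚ q) roots k))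
  where
  roots : UnboundedRoots (p -ₚ q)
  roots N = map₂ (λ {l} → map₂ λ p≡q → trans (eval₁--ₚ p q (+ l)) (ℤ.i≡j⇒i-j≡0 p≡q)) (agree N)

evens-unbounded : ∀ {P : ℕ → Set} → (∀ l → 2 ∣ l → P l) → Unbounded P
evens-unbounded P-even N = N ℕ.* 2 , ℕ.m≤m*n N 2 , P-even (N ℕ.* 2) (divides N refl)

odds-unbounded : ∀ {P : ℕ → Set} → (∀ l → ¬ 2 ∣ l → P l) → Unbounded P
odds-unbounded P-odd N = suc (N ℕ.* 2) , ℕ.m≤n⇒m≤1+n (ℕ.m≤m*n N 2) , P-odd (suc (N ℕ.* 2)) odd
  where
  odd : ¬ 2 ∣ suc (N ℕ.* 2)
  odd 2∣ = contradiction (∣1⇒≡1 (∣m+n∣m⇒∣n (subst (2 ∣_) (ℕ.+-comm 1 (N ℕ.* 2)) 2∣) (divides N refl))) λ ()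

E₂-diagonal : ∀ G E₂ → IsE₂ G E₂ → ∀ l → eval₂ E₂ (+ l) (+ l) ≡ + f₁ (G ⁺) l
E₂-diagonal G E₂ isE₂ l = begin
  eval₂ E₂ (+ l) (+ l)  ≡⟨ isE₂ l l ℕ.≤-refl (∣n∸n 2 l) C C-isColourSet ⟨
  + count G C           ≡⟨ cong +_ (count-relabel G (Cuni l)) ⟩
  + f₁ (G ⁺) l          ∎
  where
  open ≡-Reasoning
  open PositiveRelabelling zigzag-injective
  C : List ℤ
  C = map +[1+_] (map zigzag (Cuni l))
  C-isColourSet : IsColourSet l l C
  C-isColourSet = positive-isColourSet (map zigzag (Cuni l))
    (Unique.map⁺ zigzag-injective (Cuni-unique l))
    (trans (length-map zigzag (Cuni l)) (length-Cuni l))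

lemma4p13 : (G : SignedGraph) (E₂ : Poly₂) (E⁺ O⁺ : Poly₁) →
            IsE₂ G E₂ → IsE₁ (G ⁺) E⁺ → IsO₁ (G ⁺) O⁺ →
            DiagEq E₂ E⁺ × PolyEq E⁺ O⁺
lemma4p13 G E₂ E⁺ O⁺ isE₂ isE⁺ isO⁺ =
  (λ k → trans (sym (coeff₁-diagonal E₂ k)) (diagonal≡E⁺ k)) ,
  (λ k → trans (sym (diagonal≡E⁺ k)) (diagonal≡O⁺ k))
  where
  diagonal≡f⁺ : ∀ l → eval₁ (diagonal E₂) (+ l) ≡ + f₁ (G ⁺) l
  diagonal≡f⁺ l = trans (eval₁-diagonal E₂ (+ l)) (E₂-diagonal G E₂ isE₂ l)

  diagonal≡E⁺ : PolyEq (diagonal E₂) E⁺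
  diagonal≡E⁺ = unboundedAgreement⇒PolyEq (diagonal E₂) E⁺
    (evens-unbounded λ l 2∣l → trans (diagonal≡f⁺ l) (isE⁺ l 2∣l))

  diagonal≡O⁺ : PolyEq (diagonal E₂) O⁺
  diagonal≡O⁺ = unboundedAgreement⇒PolyEq (diagonal E₂) O⁺
    (odds-unbounded λ l 2∤l → trans (diagonal≡f⁺ l) (isO⁺ l 2∤l))
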